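{- Let $\mathcal{M}$ be a $2$-divisible multiset of points in $\mathrm{PG}(v-1,2)$ with cardinality $5$. Then either $\mathcal{M}=\chi_L+2\cdot\chi_P$, where $L$ is a line and $P$ a point, or $\mathcal{M}$ is the characteristic function of a projective base of size $5$.
   Context: $\mathrm{PG}(v-1,2)$ is the projective geometry of $\mathbb{F}_2^v$; points, lines, planes, hyperplanes are subspaces of dimension $1$, $2$, $3$, $v-1$. A multiset of points $\mathcal{M}$ assigns to each point $P$ a multiplicity $\mathcal{M}(P)\in\{0,1,2,\dots\}$; $\mathcal{M}(K)=\sum_{P\le K}\mathcal{M}(P)$ for a subspace $K$, and $\#\mathcal{M}=\mathcal{M}(\mathbb{F}_2^v)$. $\mathcal{M}$ is $\Delta$-divisible if $\mathcal{M}(H)\equiv\#\mathcal{M}\pmod\Delta$ for every hyperplane $H$. For a subspace or set of points $K$, $\chi_K$ has multiplicity $1$ on the points of $K$ and $0$ elsewhere; operations on multisets are pointwise. A projective base of size $n$ is a set of $n$ points such that any $n-1$ of them span an $(n-1)$-dimensional subspace. -}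

module Defs where

open import Data.Nat using (ℕ; zero; suc; _+_; _*_)
open import Data.Bool using (Bool; true; false; _∧_; _∨_; _xor_; not; if_then_else_)
open import Data.List using (List; []; _∷_; map; filter)
open import Data.Nat.ListAction using (sum)
open import Data.Bool.ListAction using (any)
open import Data.Vec using (Vec; []; _∷_; removeAt; foldr; zipWith; replicate; toList)
open import Data.Fin using (Fin)
open import Relation.Nullary using (¬_)
open import Relation.Binary.PropositionalEquality using (_≡_)
open import Data.Nat.DivMod using (_%_)

-- The ambient space F₂^v, vectors as Vec Bool v (true = 1, xor = +, ∧ = ·).
-- A point of PG(v-1,2) is a nonzero vector (1-dim subspace of F₂^v over F₂).

allVecs : (v : ℕ) → List (Vec Bool v)
allVecs zero = [] ∷ []
allVecs (suc v) = map (false ∷_) (allVecs v) Data.List.++ map (true ∷_) (allVecs v)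

isNonzero : ∀ {v} → Vec Bool v → Bool
isNonzero = foldr _ _∨_ false

points : (v : ℕ) → List (Vec Bool v)
points v = filter (λ x → Data.Bool._≟_ (isNonzero x) true) (allVecs v)

NonzeroVec : ∀ {v} → Vec Bool v → Set
NonzeroVec x = isNonzero x ≡ true

vadd : ∀ {v} → Vec Bool v → Vec Bool v → Vec Bool v
vadd = zipWith _xor_

zeroVec : ∀ {v} → Vec Bool v
zeroVec = replicate _ false

veq : ∀ {v} → Vec Bool v → Vec Bool v → Bool
veq [] [] = true
veq (a ∷ x) (b ∷ y) = not (a xor b) ∧ veq x y

dot : ∀ {v} → Vec Bool v → Vec Bool v → Bool
dot x y = foldr _ _xor_ false (zipWith _∧_ x y)

-- A multiset of points: a multiplicity for each vector; only the values on
-- nonzero vectors (the points) are ever used.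
Multiset : ℕ → Set
Multiset v = Vec Bool v → ℕ

mass : ∀ {v} → Multiset v → (Vec Bool v → Bool) → ℕ
mass {v} M K = sum (map (λ x → if K x then M x else 0) (points v))

card : ∀ {v} → Multiset v → ℕ
card {v} M = sum (map M (points v))

-- hyperplanes of F₂^v are exactly the kernels {x | a·x = 0} for nonzero a
inHyperplane : ∀ {v} → Vec Bool v → Vec Bool v → Bool
inHyperplane a x = not (dot a x)

TwoDivisible : ∀ {v} → Multiset v → Set
TwoDivisible {v} M = ∀ (a : Vec Bool v) → NonzeroVec a →
  mass M (inHyperplane a) % 2 ≡ card M % 2

chi : ∀ {v} → List (Vec Bool v) → Multiset v
chi xs x = if any (veq x) xs then 1 else 0

-- the line spanned by two distinct points p, q has points p, q, p+q
lineThrough : ∀ {v} → Vec Bool v → Vec Bool v → List (Vec Bool v)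
lineThrough p q = p ∷ q ∷ vadd p q ∷ []

linComb : ∀ {v k} → Vec Bool k → Vec (Vec Bool v) k → Vec Bool v
linComb [] [] = zeroVec
linComb (c ∷ cs) (b ∷ bs) = if c then vadd b (linComb cs bs) else linComb cs bs

LinIndep : ∀ {v k} → Vec (Vec Bool v) k → Set
LinIndep {v} {k} bs = ∀ (c : Vec Bool k) → NonzeroVec c → ¬ (linComb c bs ≡ zeroVec)

ProjectiveBase : ∀ {v n} → Vec (Vec Bool v) (suc n) → Set
ProjectiveBase {n = n} bs =
  (∀ i → NonzeroVec (Data.Vec.lookup bs i)) × (∀ (i : Fin (suc n)) → LinIndep (removeAt bs i))
  where open import Data.Product using (_×_)

-- Write the multiset as the list E of its five points, each repeated as often as its
-- multiplicity. Testing 2-divisibility on the coordinate hyperplanes shows that the points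
-- of E sum to zero. If some point P occurs twice in E, the remaining three points sum to
-- zero and hence form a line L, so M = χ_L + 2·χ_P. Otherwise E consists of five distinct
-- points summing to zero; a linear relation among four of them, complemented if necessary,
-- becomes a relation among at most two of the five, forcing a zero point or a repeated one.
-- So any four of them are independent, i.e. they form a projective base.
module Submission where

open import Defs
open import Data.Bool using (Bool; true; false; not; _∨_; _xor_; if_then_else_)
import Data.Bool as Bool
open import Data.Bool.Properties using (xor-assoc; xor-comm; xor-same; xor-identityʳ; ∨-identityʳ)
open import Data.Empty using (⊥-elim)
open import Data.Fin using (Fin; zero; suc)
open import Data.List using (List; []; _∷_; _++_; length; map; replicate; concatMap; filter; foldr)
open import Data.List.Properties using (map-++; map-∘; map-cong)
open import Data.List.Membership.Propositional using (_∈_)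
open import Data.List.Membership.Propositional.Properties using (∈-∃++)
import Data.List.Membership.DecPropositional as DecMembership
open import Data.List.Relation.Unary.All using (All; []; _∷_)
import Data.List.Relation.Unary.All as All
open import Data.List.Relation.Unary.All.Properties using (all-filter; ++⁺; replicate⁺; ¬Any⇒All¬)
open import Data.List.Relation.Unary.Any using (here; there)
open import Data.List.Relation.Unary.AllPairs using ([]; _∷_)
open import Data.List.Relation.Unary.Unique.Propositional using (Unique)
open import Data.List.Relation.Binary.Permutation.Propositional using (_↭_; prep; ↭-trans)
open import Data.List.Relation.Binary.Permutation.Propositional.Properties
  using (shift; shifts; ↭-length; All-resp-↭; map⁺)
open import Data.Nat using (ℕ; zero; suc; _+_; _*_; _≤_; _<_; _≤?_; z≤n; s≤s)
open import Data.Nat.DivMod using (_%_; %-distribˡ-+)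
open import Data.Nat.ListAction using (sum)
open import Data.Nat.ListAction.Properties using (sum-++; sum-↭)
open import Data.Nat.Properties
  using ( +-assoc; +-comm; +-suc; +-identityʳ; *-identityˡ; suc-injective
        ; ≰⇒>; ≤-trans; ≤-refl; +-monoˡ-≤; +-cancelˡ-≤)
open import Data.Product using (Σ; _×_; _,_)
open import Data.Sum using (_⊎_; inj₁; inj₂)
open import Data.Vec using (Vec; []; _∷_; toList; lookup; removeAt; insertAt; countᵇ)
import Data.Vec as V
open import Data.Vec.Properties using (≡-dec; lookup-replicate; lookup-zipWith)
open import Data.Vec.Relation.Binary.Pointwise.Inductive
  using (Pointwise-≡⇒≡; zipWith-assoc; zipWith-comm; zipWith-identityˡ; zipWith-identityʳ)
open import Data.Vec.Relation.Unary.All.Properties using (lookup⁺; toList⁻)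
open import Function using (_∘_; id)
open import Relation.Nullary using (¬_; yes; no)
open import Relation.Binary.PropositionalEquality
  using (_≡_; _≢_; refl; sym; trans; cong; cong₂; subst; module ≡-Reasoning)

open ≡-Reasoning

private
  variable
    v n : ℕ

vadd-assoc : (a b c : Vec Bool v) → vadd (vadd a b) c ≡ vadd a (vadd b c)
vadd-assoc a b c = Pointwise-≡⇒≡ (zipWith-assoc xor-assoc a b c)

vadd-comm : (a b : Vec Bool v) → vadd a b ≡ vadd b a
vadd-comm a b = Pointwise-≡⇒≡ (zipWith-comm xor-comm a b)

vadd-identityˡ : (a : Vec Bool v) → vadd zeroVec a ≡ a
vadd-identityˡ a = Pointwise-≡⇒≡ (zipWith-identityˡ (λ _ → refl) a)

vadd-identityʳ : (a : Vec Bool v) → vadd a zeroVec ≡ a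
vadd-identityʳ a = Pointwise-≡⇒≡ (zipWith-identityʳ xor-identityʳ a)

vadd-self : (a : Vec Bool v) → vadd a a ≡ zeroVec
vadd-self []      = refl
vadd-self (x ∷ a) = cong₂ _∷_ (xor-same x) (vadd-self a)

vadd-cancelˡ : (a b : Vec Bool v) → vadd a (vadd a b) ≡ b
vadd-cancelˡ a b = begin
  vadd a (vadd a b)  ≡⟨ vadd-assoc a a b ⟨
  vadd (vadd a a) b  ≡⟨ cong (λ t → vadd t b) (vadd-self a) ⟩
  vadd zeroVec b     ≡⟨ vadd-identityˡ b ⟩
  b                  ∎

vadd-swap : (a b c : Vec Bool v) → vadd a (vadd b c) ≡ vadd b (vadd a c)
vadd-swap a b c = begin
  vadd a (vadd b c)  ≡⟨ vadd-assoc a b c ⟨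
  vadd (vadd a b) c  ≡⟨ cong (λ t → vadd t c) (vadd-comm a b) ⟩
  vadd (vadd b a) c  ≡⟨ vadd-assoc b a c ⟩
  vadd b (vadd a c)  ∎

vadd≡zero⇒≡ : {a b : Vec Bool v} → vadd a b ≡ zeroVec → a ≡ b
vadd≡zero⇒≡ {a = a} {b} a+b≡0 = begin
  a                  ≡⟨ vadd-identityʳ a ⟨
  vadd a zeroVec     ≡⟨ cong (vadd a) a+b≡0 ⟨
  vadd a (vadd a b)  ≡⟨ vadd-cancelˡ a b ⟩
  b                  ∎

≡vadd⇒≡zero : {a b : Vec Bool v} → a ≡ vadd a b → b ≡ zeroVec
≡vadd⇒≡zero {a = a} {b} a≡a+b = begin
  b                  ≡⟨ vadd-cancelˡ a b ⟨
  vadd a (vadd a b)  ≡⟨ cong (vadd a) a≡a+b ⟨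
  vadd a a           ≡⟨ vadd-self a ⟩
  zeroVec            ∎

isNonzero-zeroVec : isNonzero (zeroVec {v}) ≡ false
isNonzero-zeroVec {zero}  = refl
isNonzero-zeroVec {suc v} = isNonzero-zeroVec {v}

nonzero⇒≢zeroVec : {a : Vec Bool v} → NonzeroVec a → a ≢ zeroVec
nonzero⇒≢zeroVec {v} a≢0 refl with trans (sym a≢0) (isNonzero-zeroVec {v})
... | ()

veq⇒≡ : (a b : Vec Bool v) → veq a b ≡ true → a ≡ b
veq⇒≡ []          []          _  = refl
veq⇒≡ (true ∷ a)  (true ∷ b)  eq = cong (true ∷_) (veq⇒≡ a b eq)
veq⇒≡ (false ∷ a) (false ∷ b) eq = cong (false ∷_) (veq⇒≡ a b eq)
veq⇒≡ (true ∷ a)  (false ∷ b) ()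
veq⇒≡ (false ∷ a) (true ∷ b)  ()

vsum : List (Vec Bool v) → Vec Bool v
vsum = foldr vadd zeroVec

vsum-triple≡zero⇒third≡sum : {a b c : Vec Bool v} → vsum (a ∷ b ∷ c ∷ []) ≡ zeroVec → vadd a b ≡ c
vsum-triple≡zero⇒third≡sum {a = a} {b} {c} sum≡0 = vadd≡zero⇒≡ (begin
  vadd (vadd a b) c               ≡⟨ vadd-assoc a b c ⟩
  vadd a (vadd b c)               ≡⟨ cong (λ t → vadd a (vadd b t)) (vadd-identityʳ c) ⟨
  vsum (a ∷ b ∷ c ∷ [])           ≡⟨ sum≡0 ⟩
  zeroVec                         ∎)

lineThrough-unique : {p q : Vec Bool v} → NonzeroVec p → NonzeroVec q → p ≢ q → Unique (lineThrough p q)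
lineThrough-unique {p = p} {q} p≢0 q≢0 p≢q = (p≢q ∷ p≢p+q ∷ []) ∷ (q≢p+q ∷ []) ∷ [] ∷ []
  where
  p≢p+q : p ≢ vadd p q
  p≢p+q = nonzero⇒≢zeroVec q≢0 ∘ ≡vadd⇒≡zero
  q≢p+q : q ≢ vadd p q
  q≢p+q q≡p+q = nonzero⇒≢zeroVec p≢0 (≡vadd⇒≡zero (trans q≡p+q (vadd-comm p q)))

𝟙 : Bool → ℕ
𝟙 b = if b then 1 else 0

count : {A : Set} → (A → Bool) → List A → ℕ
count K xs = sum (map (𝟙 ∘ K) xs)

module _ {A : Set} where

  count-++ : (K : A → Bool) (xs ys : List A) → count K (xs ++ ys) ≡ count K xs + count K ys
  count-++ K xs ys = trans (cong sum (map-++ (𝟙 ∘ K) xs ys)) (sum-++ (map (𝟙 ∘ K) xs) _)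

  count-↭ : (K : A → Bool) {xs ys : List A} → xs ↭ ys → count K xs ≡ count K ys
  count-↭ K xs↭ys = sum-↭ (map⁺ (𝟙 ∘ K) xs↭ys)

  count-map : {B : Set} (K : B → Bool) (f : A → B) (xs : List A) → count K (map f xs) ≡ count (K ∘ f) xs
  count-map K f xs = cong sum (sym (map-∘ xs))

  count-false : (xs : List A) → count (λ _ → false) xs ≡ 0
  count-false []       = refl
  count-false (_ ∷ xs) = count-false xs

  count-true : (xs : List A) → count (λ _ → true) xs ≡ length xs
  count-true []       = refl
  count-true (_ ∷ xs) = cong suc (count-true xs)

  count-replicate : (K : A → Bool) (m : ℕ) (x : A) → count K (replicate m x) ≡ (if K x then m else 0)
  count-replicate K zero    x with K x
  ... | true  = refl
  ... | false = refl
  count-replicate K (suc m) x with K x | count-replicate K m x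
  ... | true  | ih = cong suc ih
  ... | false | ih = ih

  count-not+count : (K : A → Bool) (xs : List A) → count (not ∘ K) xs + count K xs ≡ length xs
  count-not+count K []       = refl
  count-not+count K (x ∷ xs) with K x
  ... | true  = trans (+-suc (count (not ∘ K) xs) (count K xs)) (cong suc (count-not+count K xs))
  ... | false = cong suc (count-not+count K xs)

𝟙%2 : (a : Bool) → 𝟙 a % 2 ≡ 𝟙 a
𝟙%2 true  = refl
𝟙%2 false = refl

%2-+ : (m n : ℕ) {a b : Bool} → m % 2 ≡ 𝟙 a → n % 2 ≡ 𝟙 b → (m + n) % 2 ≡ 𝟙 (a xor b)
%2-+ m n {a} {b} m≡a n≡b = begin
  (m + n) % 2              ≡⟨ %-distribˡ-+ m n 2 ⟩
  (m % 2 + n % 2) % 2      ≡⟨ cong₂ (λ s t → (s + t) % 2) m≡a n≡b ⟩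
  (𝟙 a + 𝟙 b) % 2          ≡⟨ 𝟙-xor a b ⟩
  𝟙 (a xor b)              ∎
  where
  𝟙-xor : ∀ a b → (𝟙 a + 𝟙 b) % 2 ≡ 𝟙 (a xor b)
  𝟙-xor true  true  = refl
  𝟙-xor true  false = refl
  𝟙-xor false true  = refl
  𝟙-xor false false = refl

xorSum : List Bool → Bool
xorSum = foldr _xor_ false

count%2≡xorSum : {A : Set} (K : A → Bool) (xs : List A) → count K xs % 2 ≡ 𝟙 (xorSum (map K xs))
count%2≡xorSum K []       = refl
count%2≡xorSum K (x ∷ xs) = %2-+ (𝟙 (K x)) (count K xs) (𝟙%2 (K x)) (count%2≡xorSum K xs)

count-veq-∉ : {y : Vec Bool v} (xs : List (Vec Bool v)) → All (y ≢_) xs → count (veq y) xs ≡ 0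
count-veq-∉ []       []            = refl
count-veq-∉ {y = y} (w ∷ xs) (y≢w ∷ y∉xs) with veq y w in eq
... | true  = ⊥-elim (y≢w (veq⇒≡ y w eq))
... | false = count-veq-∉ xs y∉xs

count-veq-unique : {xs : List (Vec Bool v)} → Unique xs → (z : Vec Bool v) → count (veq z) xs ≡ chi xs z
count-veq-unique []                           z = refl
count-veq-unique {xs = y ∷ xs} (y∉xs ∷ xs!) z with veq z y in eq
... | true rewrite veq⇒≡ z y eq = cong suc (count-veq-∉ xs y∉xs)
... | false = count-veq-unique xs! z

count-veq-allVecs : (z : Vec Bool v) → count (veq z) (allVecs v) ≡ 1
count-veq-allVecs []              = refl
count-veq-allVecs {suc v} (b ∷ z) = begin
  count (veq (b ∷ z)) (map (false ∷_) (allVecs v) ++ map (true ∷_) (allVecs v))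
    ≡⟨ count-++ (veq (b ∷ z)) (map (false ∷_) (allVecs v)) _ ⟩
  count (veq (b ∷ z)) (map (false ∷_) (allVecs v)) + count (veq (b ∷ z)) (map (true ∷_) (allVecs v))
    ≡⟨ cong₂ _+_ (count-map (veq (b ∷ z)) (false ∷_) (allVecs v))
                 (count-map (veq (b ∷ z)) (true ∷_) (allVecs v)) ⟩
  count (veq (b ∷ z) ∘ (false ∷_)) (allVecs v) + count (veq (b ∷ z) ∘ (true ∷_)) (allVecs v)
    ≡⟨ first-coordinate b ⟩
  1 ∎
  where
  first-coordinate : ∀ b →
    count (veq (b ∷ z) ∘ (false ∷_)) (allVecs v) + count (veq (b ∷ z) ∘ (true ∷_)) (allVecs v) ≡ 1
  first-coordinate false = cong₂ _+_ (count-veq-allVecs z) (count-false (allVecs v))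
  first-coordinate true  = cong₂ _+_ (count-false (allVecs v)) (count-veq-allVecs z)

count-veq-points : (z : Vec Bool v) → NonzeroVec z → count (veq z) (points v) ≡ 1
count-veq-points {v} z z≢0 = trans (dropZeros (allVecs v)) (count-veq-allVecs z)
  where
  dropZeros : (xs : List (Vec Bool v)) →
    count (veq z) (filter (λ x → isNonzero x Bool.≟ true) xs) ≡ count (veq z) xs
  dropZeros []       = refl
  dropZeros (y ∷ xs) with isNonzero y Bool.≟ true
  ... | yes _ = cong (𝟙 (veq z y) +_) (dropZeros xs)
  ... | no y≡0 with veq z y in eq
  ...   | true  = ⊥-elim (y≡0 (subst NonzeroVec (veq⇒≡ z y eq) z≢0))
  ...   | false = dropZeros xs

points-nonzero : (v : ℕ) → All NonzeroVec (points v)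
points-nonzero v = all-filter (λ x → isNonzero x Bool.≟ true) (allVecs v)

expand : Multiset v → List (Vec Bool v) → List (Vec Bool v)
expand M = concatMap (λ x → replicate (M x) x)

All-expand : (M : Multiset v) {xs : List (Vec Bool v)} → All NonzeroVec xs → All NonzeroVec (expand M xs)
All-expand M []                     = []
All-expand M {x ∷ _} (x≢0 ∷ xs≢0) = ++⁺ (replicate⁺ (M x) x≢0) (All-expand M xs≢0)

weighted-sum≡count-expand : (M : Multiset v) (K : Vec Bool v → Bool) (xs : List (Vec Bool v)) →
  sum (map (λ x → if K x then M x else 0) xs) ≡ count K (expand M xs)
weighted-sum≡count-expand M K []       = refl
weighted-sum≡count-expand M K (x ∷ xs) = begin
  (if K x then M x else 0) + sum (map (λ y → if K y then M y else 0) xs)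
    ≡⟨ cong₂ _+_ (sym (count-replicate K (M x) x)) (weighted-sum≡count-expand M K xs) ⟩
  count K (replicate (M x) x) + count K (expand M xs)
    ≡⟨ count-++ K (replicate (M x) x) (expand M xs) ⟨
  count K (expand M (x ∷ xs)) ∎

weighted-sum-veq : (M : Multiset v) (z : Vec Bool v) (xs : List (Vec Bool v)) →
  sum (map (λ y → if veq z y then M y else 0) xs) ≡ count (veq z) xs * M z
weighted-sum-veq M z []       = refl
weighted-sum-veq M z (y ∷ xs) with veq z y in eq
... | true rewrite veq⇒≡ z y eq = cong (M y +_) (weighted-sum-veq M y xs)
... | false = weighted-sum-veq M z xs

_Enumerates_ : List (Vec Bool v) → Multiset v → Set
_Enumerates_ {v} E M = (z : Vec Bool v) → NonzeroVec z → M z ≡ count (veq z) E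

Enumerates-resp-↭ : {M : Multiset v} {E F : List (Vec Bool v)} → E ↭ F → E Enumerates M → F Enumerates M
Enumerates-resp-↭ E↭F E⇉M z z≢0 = trans (E⇉M z z≢0) (count-↭ (veq z) E↭F)

expand-enumerates : (M : Multiset v) → expand M (points v) Enumerates M
expand-enumerates {v} M z z≢0 = begin
  M z                                                         ≡⟨ *-identityˡ (M z) ⟨
  1 * M z                                                     ≡⟨ cong (_* M z) (count-veq-points z z≢0) ⟨
  count (veq z) (points v) * M z                              ≡⟨ weighted-sum-veq M z (points v) ⟨
  sum (map (λ y → if veq z y then M y else 0) (points v))     ≡⟨ weighted-sum≡count-expand M (veq z) (points v) ⟩
  count (veq z) (expand M (points v))                         ∎

length-expand : (M : Multiset v) → length (expand M (points v)) ≡ card M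
length-expand {v} M = begin
  length (expand M (points v))              ≡⟨ count-true (expand M (points v)) ⟨
  count (λ _ → true) (expand M (points v))  ≡⟨ weighted-sum≡count-expand M (λ _ → true) (points v) ⟨
  card M                                    ∎

TwoDivisibleList : List (Vec Bool v) → Set
TwoDivisibleList {v} E = (a : Vec Bool v) → NonzeroVec a → count (inHyperplane a) E % 2 ≡ length E % 2

TwoDivisibleList-resp-↭ : {E F : List (Vec Bool v)} → E ↭ F → TwoDivisibleList E → TwoDivisibleList F
TwoDivisibleList-resp-↭ {E = E} {F} E↭F div a a≢0 = begin
  count (inHyperplane a) F % 2  ≡⟨ cong (_% 2) (count-↭ (inHyperplane a) E↭F) ⟨
  count (inHyperplane a) E % 2  ≡⟨ div a a≢0 ⟩
  length E % 2                  ≡⟨ cong (_% 2) (↭-length E↭F) ⟩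
  length F % 2                  ∎

twoDivisible⇒twoDivisibleList : (M : Multiset v) → TwoDivisible M → TwoDivisibleList (expand M (points v))
twoDivisible⇒twoDivisibleList {v} M div a a≢0 = begin
  count (inHyperplane a) (expand M (points v)) % 2
    ≡⟨ cong (_% 2) (weighted-sum≡count-expand M (inHyperplane a) (points v)) ⟨
  mass M (inHyperplane a) % 2       ≡⟨ div a a≢0 ⟩
  card M % 2                        ≡⟨ cong (_% 2) (length-expand M) ⟨
  length (expand M (points v)) % 2  ∎

unit : Fin v → Vec Bool v
unit zero    = true ∷ zeroVec
unit (suc i) = false ∷ unit i

unit-nonzero : (i : Fin v) → NonzeroVec (unit i)
unit-nonzero zero    = refl
unit-nonzero (suc i) = unit-nonzero i

dot-zeroVecˡ : (x : Vec Bool v) → dot zeroVec x ≡ false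
dot-zeroVecˡ []      = refl
dot-zeroVecˡ (_ ∷ x) = dot-zeroVecˡ x

dot-unit : (i : Fin v) (x : Vec Bool v) → dot (unit i) x ≡ lookup x i
dot-unit zero    (b ∷ x) = trans (cong (b xor_) (dot-zeroVecˡ x)) (xor-identityʳ b)
dot-unit (suc i) (_ ∷ x) = dot-unit i x

lookup-vsum : (xs : List (Vec Bool v)) (i : Fin v) → lookup (vsum xs) i ≡ xorSum (map (λ x → lookup x i) xs)
lookup-vsum []       i = lookup-replicate i false
lookup-vsum (x ∷ xs) i = trans (lookup-zipWith _xor_ i x (vsum xs)) (cong (lookup x i xor_) (lookup-vsum xs i))

zeroVec-ext : (s : Vec Bool v) → (∀ i → lookup s i ≡ false) → s ≡ zeroVec
zeroVec-ext []      _   = refl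
zeroVec-ext (b ∷ s) s≡0 = cong₂ _∷_ (s≡0 zero) (zeroVec-ext s (s≡0 ∘ suc))

𝟙≡𝟙-xor⇒≡false : (a b : Bool) → 𝟙 a ≡ 𝟙 (a xor b) → b ≡ false
𝟙≡𝟙-xor⇒≡false true  false _ = refl
𝟙≡𝟙-xor⇒≡false false false _ = refl
𝟙≡𝟙-xor⇒≡false true  true  ()
𝟙≡𝟙-xor⇒≡false false true  ()

twoDivisible⇒vsum≡zero : (E : List (Vec Bool v)) → TwoDivisibleList E → vsum E ≡ zeroVec
twoDivisible⇒vsum≡zero {v} E div = zeroVec-ext (vsum E) coordinate
  where
  coordinate : ∀ i → lookup (vsum E) i ≡ false
  coordinate i = trans (lookup-vsum E i) (𝟙≡𝟙-xor⇒≡false _ _ (begin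
    𝟙 (xorSum (map (not ∘ xᵢ) E))                      ≡⟨ count%2≡xorSum (not ∘ xᵢ) E ⟨
    count (not ∘ xᵢ) E % 2                              ≡⟨ cong (_% 2) hyperplaneᵢ ⟨
    count (inHyperplane (unit i)) E % 2                 ≡⟨ div (unit i) (unit-nonzero i) ⟩
    length E % 2                                        ≡⟨ cong (_% 2) (count-not+count xᵢ E) ⟨
    (count (not ∘ xᵢ) E + count xᵢ E) % 2               ≡⟨ %2-+ (count (not ∘ xᵢ) E) (count xᵢ E)
                                                              (count%2≡xorSum (not ∘ xᵢ) E) (count%2≡xorSum xᵢ E) ⟩
    𝟙 (xorSum (map (not ∘ xᵢ) E) xor xorSum (map xᵢ E))  ∎))
    where
    xᵢ : Vec Bool v → Bool
    xᵢ x = lookup x i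
    hyperplaneᵢ : count (inHyperplane (unit i)) E ≡ count (not ∘ xᵢ) E
    hyperplaneᵢ = cong sum (map-cong (λ x → cong (𝟙 ∘ not) (dot-unit i x)) E)

weight : Vec Bool n → ℕ
weight = countᵇ id

weight-complement : (c : Vec Bool n) → weight c + weight (V.map not c) ≡ n
weight-complement []          = refl
weight-complement (true ∷ c)  = cong suc (weight-complement c)
weight-complement (false ∷ c) = trans (+-suc (weight c) _) (cong suc (weight-complement c))

nonzero⇒weight>0 : (c : Vec Bool n) → NonzeroVec c → 0 < weight c
nonzero⇒weight>0 (true ∷ c)  _   = s≤s z≤n
nonzero⇒weight>0 (false ∷ c) c≢0 = nonzero⇒weight>0 c c≢0

insertAt-nonzero : (c : Vec Bool n) (i : Fin (suc n)) → NonzeroVec c → NonzeroVec (insertAt c i false)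
insertAt-nonzero c           zero    c≢0 = c≢0
insertAt-nonzero (true ∷ c)  (suc i) _   = refl
insertAt-nonzero (false ∷ c) (suc i) c≢0 = insertAt-nonzero c i c≢0

insertAt-complement-nonzero : (c : Vec Bool n) (i : Fin (suc n)) → NonzeroVec (V.map not (insertAt c i false))
insertAt-complement-nonzero c           zero    = refl
insertAt-complement-nonzero (true ∷ c)  (suc i) = insertAt-complement-nonzero c i
insertAt-complement-nonzero (false ∷ c) (suc i) = refl

linComb-removeAt : (c : Vec Bool n) (bs : Vec (Vec Bool v) (suc n)) (i : Fin (suc n)) →
  linComb c (removeAt bs i) ≡ linComb (insertAt c i false) bs
linComb-removeAt c           (b ∷ bs)      zero    = refl
linComb-removeAt (true ∷ c)  (b ∷ b′ ∷ bs) (suc i) = cong (vadd b) (linComb-removeAt c (b′ ∷ bs) i)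
linComb-removeAt (false ∷ c) (b ∷ b′ ∷ bs) (suc i) = linComb-removeAt c (b′ ∷ bs) i

linComb-complement : (c : Vec Bool n) (bs : Vec (Vec Bool v) n) →
  vadd (linComb c bs) (linComb (V.map not c) bs) ≡ vsum (toList bs)
linComb-complement []          []       = vadd-identityˡ zeroVec
linComb-complement (true ∷ c)  (b ∷ bs) =
  trans (vadd-assoc b _ _) (cong (vadd b) (linComb-complement c bs))
linComb-complement (false ∷ c) (b ∷ bs) =
  trans (vadd-swap (linComb c bs) b _) (cong (vadd b) (linComb-complement c bs))

complementary-relation : (c : Vec Bool n) (bs : Vec (Vec Bool v) n) → vsum (toList bs) ≡ zeroVec →
  linComb c bs ≡ zeroVec → linComb (V.map not c) bs ≡ zeroVec
complementary-relation c bs sum≡0 rel =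
  trans (sym (vadd≡zero⇒≡ (trans (linComb-complement c bs) sum≡0))) rel

linComb-weight0 : (c : Vec Bool n) (bs : Vec (Vec Bool v) n) → weight c ≡ 0 → linComb c bs ≡ zeroVec
linComb-weight0 []          []       _  = refl
linComb-weight0 (false ∷ c) (_ ∷ bs) w≡0 = linComb-weight0 c bs w≡0

linComb-weight1 : (c : Vec Bool n) (bs : Vec (Vec Bool v) n) → weight c ≡ 1 → linComb c bs ∈ toList bs
linComb-weight1 (true ∷ c)  (b ∷ bs) w≡1 =
  here (trans (cong (vadd b) (linComb-weight0 c bs (suc-injective w≡1))) (vadd-identityʳ b))
linComb-weight1 (false ∷ c) (_ ∷ bs) w≡1 = there (linComb-weight1 c bs w≡1)

linComb-light≢zero : {bs : Vec (Vec Bool v) n} → All NonzeroVec (toList bs) → Unique (toList bs) →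
  (c : Vec Bool n) → 0 < weight c → weight c ≤ 2 → linComb c bs ≢ zeroVec
linComb-light≢zero {bs = b ∷ bs} (b≢0 ∷ _) (b∉bs ∷ _) (true ∷ c) _ w≤2 rel
  with weight c in w≡ | w≤2
... | 0           | _ = nonzero⇒≢zeroVec b≢0 (begin
  b                          ≡⟨ vadd-identityʳ b ⟨
  vadd b zeroVec             ≡⟨ cong (vadd b) (linComb-weight0 c bs w≡) ⟨
  vadd b (linComb c bs)      ≡⟨ rel ⟩
  zeroVec                    ∎)
... | 1           | _ = All.lookup b∉bs (linComb-weight1 c bs w≡) (vadd≡zero⇒≡ rel)
... | suc (suc _) | s≤s (s≤s ())
linComb-light≢zero {bs = _ ∷ _} (_ ∷ bs≢0) (_ ∷ bs!) (false ∷ c) = linComb-light≢zero bs≢0 bs! c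

m+n≤5⇒m≤2⊎n≤2 : (m n : ℕ) → m + n ≤ 5 → m ≤ 2 ⊎ n ≤ 2
m+n≤5⇒m≤2⊎n≤2 m n m+n≤5 with m ≤? 2
... | yes m≤2 = inj₁ m≤2
... | no  m≰2 = inj₂ (+-cancelˡ-≤ 3 n 2 (≤-trans (+-monoˡ-≤ n (≰⇒> m≰2)) m+n≤5))

no-proper-relation : n ≤ 4 → (bs : Vec (Vec Bool v) (suc n)) → All NonzeroVec (toList bs) →
  Unique (toList bs) → vsum (toList bs) ≡ zeroVec →
  (c : Vec Bool (suc n)) → NonzeroVec c → NonzeroVec (V.map not c) → linComb c bs ≢ zeroVec
no-proper-relation n≤4 bs bs≢0 bs! sum≡0 c c≢0 c̄≢0 rel
  with m+n≤5⇒m≤2⊎n≤2 (weight c) (weight (V.map not c))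
         (subst (_≤ 5) (sym (weight-complement c)) (s≤s n≤4))
... | inj₁ w≤2 = linComb-light≢zero bs≢0 bs! c (nonzero⇒weight>0 c c≢0) w≤2 rel
... | inj₂ w≤2 = linComb-light≢zero bs≢0 bs! (V.map not c) (nonzero⇒weight>0 (V.map not c) c̄≢0) w≤2
                   (complementary-relation c bs sum≡0 rel)

zero-sum⇒projectiveBase : n ≤ 4 → (bs : Vec (Vec Bool v) (suc n)) → All NonzeroVec (toList bs) →
  Unique (toList bs) → vsum (toList bs) ≡ zeroVec → ProjectiveBase bs
zero-sum⇒projectiveBase n≤4 bs bs≢0 bs! sum≡0 = lookup⁺ (toList⁻ bs≢0) , independent
  where
  independent : ∀ i → LinIndep (removeAt bs i)
  independent i c c≢0 rel = no-proper-relation n≤4 bs bs≢0 bs! sum≡0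
    (insertAt c i false) (insertAt-nonzero c i c≢0) (insertAt-complement-nonzero c i)
    (trans (sym (linComb-removeAt c bs i)) rel)

unique⊎duplicate : (xs : List (Vec Bool v)) →
  Unique xs ⊎ Σ (Vec Bool v) λ x → Σ (List (Vec Bool v)) λ ys → xs ↭ x ∷ x ∷ ys
unique⊎duplicate []       = inj₁ []
unique⊎duplicate (a ∷ xs) with unique⊎duplicate xs
... | inj₂ (x , ys , xs↭) = inj₂ (x , a ∷ ys , ↭-trans (prep a xs↭) (shifts (a ∷ []) (x ∷ x ∷ [])))
... | inj₁ xs! with DecMembership._∈?_ (≡-dec Bool._≟_) a xs
...   | no a∉xs = inj₁ (¬Any⇒All¬ xs a∉xs ∷ xs!)
...   | yes a∈xs with ys , zs , refl ← ∈-∃++ a∈xs = inj₂ (a , ys ++ zs , prep a (shift a ys zs))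

IsLinePlusDoublePoint : Multiset v → Set
IsLinePlusDoublePoint {v} M = Σ (Vec Bool v) λ p → Σ (Vec Bool v) λ q → Σ (Vec Bool v) λ r →
  NonzeroVec p × NonzeroVec q × ¬ (p ≡ q) × NonzeroVec r ×
  (∀ x → NonzeroVec x → M x ≡ chi (lineThrough p q) x + 2 * chi (r ∷ []) x)

IsProjectiveBaseSet : Multiset v → Set
IsProjectiveBaseSet {v} M = Σ (Vec (Vec Bool v) 5) λ bs → ProjectiveBase bs ×
  (∀ x → NonzeroVec x → M x ≡ chi (toList bs) x)

doubledPoint⇒linePlusDoublePoint : {M : Multiset v} {x : Vec Bool v} (ys : List (Vec Bool v)) →
  length ys ≡ 3 → All NonzeroVec (x ∷ x ∷ ys) → vsum (x ∷ x ∷ ys) ≡ zeroVec → (x ∷ x ∷ ys) Enumerates M →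
  IsLinePlusDoublePoint M
doubledPoint⇒linePlusDoublePoint {M = M} {x} (y₁ ∷ y₂ ∷ y₃ ∷ []) refl
  (x≢0 ∷ _ ∷ y₁≢0 ∷ y₂≢0 ∷ y₃≢0 ∷ []) sum≡0 enum
  with vsum-triple≡zero⇒third≡sum (trans (sym (vadd-cancelˡ x _)) sum≡0)
... | refl = y₁ , y₂ , x , y₁≢0 , y₂≢0 , y₁≢y₂ , x≢0 , multiplicity
  where
  y₁≢y₂ : y₁ ≢ y₂
  y₁≢y₂ refl = nonzero⇒≢zeroVec y₃≢0 (vadd-self y₁)
  multiplicity : ∀ z → NonzeroVec z → M z ≡ chi (lineThrough y₁ y₂) z + 2 * chi (x ∷ []) z
  multiplicity z z≢0 = begin
    M z                                                ≡⟨ enum z z≢0 ⟩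
    k + (k + count (veq z) (lineThrough y₁ y₂))        ≡⟨ cong (λ t → k + (k + t)) (count-veq-unique line! z) ⟩
    k + (k + c)                                        ≡⟨ +-assoc k k c ⟨
    (k + k) + c                                        ≡⟨ +-comm (k + k) c ⟩
    c + (k + k)                                        ≡⟨ cong (λ t → c + (k + t)) (+-identityʳ k) ⟨
    c + 2 * k                                          ≡⟨ cong (λ b → c + 2 * 𝟙 b) (∨-identityʳ (veq z x)) ⟨
    c + 2 * chi (x ∷ []) z                             ∎
    where
    k = 𝟙 (veq z x)
    c = chi (lineThrough y₁ y₂) z
    line! = lineThrough-unique y₁≢0 y₂≢0 y₁≢y₂

distinctPoints⇒projectiveBaseSet : {M : Multiset v} (E : List (Vec Bool v)) → length E ≡ 5 →
  All NonzeroVec E → Unique E → vsum E ≡ zeroVec → E Enumerates M → IsProjectiveBaseSet M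
distinctPoints⇒projectiveBaseSet (x₁ ∷ x₂ ∷ x₃ ∷ x₄ ∷ x₅ ∷ []) refl E≢0 E! sum≡0 enum =
  bs , zero-sum⇒projectiveBase ≤-refl bs E≢0 E! sum≡0 ,
  λ z z≢0 → trans (enum z z≢0) (count-veq-unique E! z)
  where
  bs : Vec (Vec Bool _) 5
  bs = x₁ ∷ x₂ ∷ x₃ ∷ x₄ ∷ x₅ ∷ []

classify-five-points : {M : Multiset v} (E : List (Vec Bool v)) → length E ≡ 5 → All NonzeroVec E →
  TwoDivisibleList E → E Enumerates M → IsLinePlusDoublePoint M ⊎ IsProjectiveBaseSet M
classify-five-points E |E|≡5 E≢0 div enum with unique⊎duplicate E
... | inj₁ E! = inj₂ (distinctPoints⇒projectiveBaseSet E |E|≡5 E≢0 E!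
                      (twoDivisible⇒vsum≡zero E div) enum)
... | inj₂ (x , ys , E↭) = inj₁ (doubledPoint⇒linePlusDoublePoint ys
        (suc-injective (suc-injective (trans (sym (↭-length E↭)) |E|≡5)))
        (All-resp-↭ E↭ E≢0)
        (twoDivisible⇒vsum≡zero (x ∷ x ∷ ys) (TwoDivisibleList-resp-↭ E↭ div))
        (Enumerates-resp-↭ E↭ enum))

proposition15 : (v : ℕ) (M : Multiset v) → TwoDivisible M → card M ≡ 5 →
    (Σ (Vec Bool v) λ p → Σ (Vec Bool v) λ q → Σ (Vec Bool v) λ r →
        NonzeroVec p × NonzeroVec q × ¬ (p ≡ q) × NonzeroVec r ×
        (∀ x → NonzeroVec x → M x ≡ chi (lineThrough p q) x + 2 * chi (r ∷ []) x))
    ⊎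
    (Σ (Vec (Vec Bool v) 5) λ bs → ProjectiveBase bs ×
        (∀ x → NonzeroVec x → M x ≡ chi (toList bs) x))
proposition15 v M div |M|≡5 =
  classify-five-points (expand M (points v))
    (trans (length-expand M) |M|≡5)
    (All-expand M (points-nonzero v))
    (twoDivisible⇒twoDivisibleList M div)
    (expand-enumerates M)
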